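{- A (finite) cubic graph $G$ has a DET:OLD set if and only if $G$ contains no $4$-cycle $C_4$ as a subgraph.
   Context: For a graph $G$ and $v\in V(G)$, $N(v)$ is the open neighborhood of $v$. For $S\subseteq V(G)$ write $N_S(v)=N(v)\cap S$. A set $S\subseteq V(G)$ is a DET:OLD set of $G$ if (1) every vertex $v\in V(G)$ satisfies $|N_S(v)|\ge 2$, and (2) every pair of distinct vertices $u,v\in V(G)$ satisfies $|N_S(u)\setminus N_S(v)|\ge 2$ or $|N_S(v)\setminus N_S(u)|\ge 2$. A cubic graph is a 3-regular simple graph. -}

module Defs where

open import Data.Nat using (ℕ; zero; suc; _+_; _≥_)
open import Data.Fin using (Fin; zero; suc)
open import Data.Bool using (Bool; true; false; _∧_; not; T)
open import Data.Product using (_×_; ∃-syntax)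
open import Data.Sum using (_⊎_)
open import Relation.Binary.PropositionalEquality using (_≡_; _≢_)

count : ∀ {n} → (Fin n → Bool) → ℕ
count {zero} p = 0
count {suc n} p = (if p zero then 1 else 0) + count (λ i → p (suc i))
  where
  if_then_else_ : Bool → ℕ → ℕ → ℕ
  if true then a else b = a
  if false then a else b = b

record Graph (n : ℕ) : Set where
  field
    adj   : Fin n → Fin n → Bool
    sym   : ∀ u v → adj u v ≡ adj v u
    irrefl : ∀ v → adj v v ≡ false

open Graph public

deg : ∀ {n} → Graph n → Fin n → ℕ
deg G v = count (adj G v)

Cubic : ∀ {n} → Graph n → Set
Cubic G = ∀ v → deg G v ≡ 3

VSet : ℕ → Set
VSet n = Fin n → Bool

nbS : ∀ {n} → Graph n → VSet n → Fin n → ℕ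
nbS G S v = count (λ w → adj G v w ∧ S w)

nbSdiff : ∀ {n} → Graph n → VSet n → Fin n → Fin n → ℕ
nbSdiff G S u v = count (λ w → (adj G u w ∧ S w) ∧ not (adj G v w ∧ S w))

IsDETOLD : ∀ {n} → Graph n → VSet n → Set
IsDETOLD G S =
  (∀ v → nbS G S v ≥ 2) ×
  (∀ u v → u ≢ v → (nbSdiff G S u v ≥ 2) ⊎ (nbSdiff G S v u ≥ 2))

HasDETOLD : ∀ {n} → Graph n → Set
HasDETOLD G = ∃[ S ] IsDETOLD G S

HasC4 : ∀ {n} → Graph n → Set
HasC4 G = ∃[ a ] ∃[ b ] ∃[ c ] ∃[ d ]
  (a ≢ b × a ≢ c × a ≢ d × b ≢ c × b ≢ d × c ≢ d) ×
  (T (adj G a b) × T (adj G b c) × T (adj G c d) × T (adj G d a))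

{-# OPTIONS --safe #-}
module Submission where

-- In a cubic graph |N(u) \ N(v)| = 3 - |N(u) ∩ N(v)|, and two distinct vertices
-- have two common neighbours exactly when they are opposite corners of a 4-cycle.
-- For opposite corners a, c we get |N_S(a) \ N_S(c)| ≤ |N(a) \ N(c)| ≤ 1 and
-- symmetrically, so no S separates a from c. Without 4-cycles any two distinct
-- vertices have at most one common neighbour, so S = V(G) is a DET:OLD set.

open import Defs hiding (sym)
open import Data.Nat using (ℕ; zero; suc; _+_; _≤_; _≥_; z≤n; s≤s; s≤s⁻¹)
open import Data.Nat.Properties using (≤-refl; ≤-trans; m≤n⇒m≤1+n; +-suc; ≤⇒≯)
open import Data.Fin using (Fin; zero; suc)
open import Data.Fin.Properties using (suc-injective)
open import Data.Bool using (Bool; true; false; _∧_; not; T)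
open import Data.Bool.Properties using (T-∧; ∧-identityʳ)
open import Data.Unit using (tt)
open import Data.Empty using (⊥-elim)
open import Data.Product using (_×_; _,_; ∃-syntax)
open import Data.Sum using (_⊎_; inj₁; inj₂)
open import Relation.Binary.PropositionalEquality
  using (_≡_; _≢_; refl; sym; trans; cong; cong₂; subst)
open import Relation.Nullary using (¬_)
open import Function.Bundles using (_⇔_; mk⇔; Equivalence)

private
  variable
    n : ℕ

tail : (Fin (suc n) → Bool) → Fin n → Bool
tail p i = p (suc i)

count-cong : {p q : Fin n → Bool} → (∀ i → p i ≡ q i) → count p ≡ count q
count-cong {zero}          eq = refl
count-cong {suc n} {p} {q} eq with p zero | q zero | eq zero
... | true  | .true  | refl = cong suc (count-cong (λ i → eq (suc i)))
... | false | .false | refl = count-cong (λ i → eq (suc i))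

count-split : (p q : Fin n → Bool) →
  count p ≡ count (λ i → p i ∧ q i) + count (λ i → p i ∧ not (q i))
count-split {zero}  p q = refl
count-split {suc n} p q with p zero | q zero
... | true  | true  = cong suc (count-split (tail p) (tail q))
... | true  | false = trans (cong suc (count-split (tail p) (tail q))) (sym (+-suc _ _))
... | false | true  = count-split (tail p) (tail q)
... | false | false = count-split (tail p) (tail q)

count-mono : (p q : Fin n → Bool) → (∀ i → T (p i) → T (q i)) → count p ≤ count q
count-mono {zero}  p q p⇒q = z≤n
count-mono {suc n} p q p⇒q with p zero | q zero | p⇒q zero
... | true  | true  | _  = s≤s (count-mono (tail p) (tail q) (λ i → p⇒q (suc i)))
... | true  | false | p₀⇒q₀ = ⊥-elim (p₀⇒q₀ tt)
... | false | true  | _  = m≤n⇒m≤1+n (count-mono (tail p) (tail q) (λ i → p⇒q (suc i)))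
... | false | false | _  = count-mono (tail p) (tail q) (λ i → p⇒q (suc i))

count-tail-≤ : (p : Fin (suc n) → Bool) → count (tail p) ≤ count p
count-tail-≤ p with p zero
... | true  = m≤n⇒m≤1+n ≤-refl
... | false = ≤-refl

count≥1 : (p : Fin n → Bool) (a : Fin n) → T (p a) → 1 ≤ count p
count≥1 p zero    pa with p zero
... | true = s≤s z≤n
count≥1 p (suc a) pa = ≤-trans (count≥1 (tail p) a pa) (count-tail-≤ p)

count≥2 : (p : Fin n → Bool) (a b : Fin n) → a ≢ b → T (p a) → T (p b) → 2 ≤ count p
count≥2 p zero    zero    a≢b _  _  = ⊥-elim (a≢b refl)
count≥2 p zero    (suc b) a≢b pa pb with p zero
... | true = s≤s (count≥1 (tail p) b pb)
count≥2 p (suc a) zero    a≢b pa pb with p zero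
... | true = s≤s (count≥1 (tail p) a pa)
count≥2 p (suc a) (suc b) a≢b pa pb =
  ≤-trans (count≥2 (tail p) a b (λ a≡b → a≢b (cong suc a≡b)) pa pb) (count-tail-≤ p)

count≥1⇒witness : (p : Fin n → Bool) → 1 ≤ count p → ∃[ a ] T (p a)
count≥1⇒witness {suc n} p h with p zero in p₀
... | true  = zero , subst T (sym p₀) tt
... | false with count≥1⇒witness (tail p) h
...   | a , pa = suc a , pa

count≥2⇒witnesses : (p : Fin n → Bool) → 2 ≤ count p →
  ∃[ a ] ∃[ b ] (a ≢ b × T (p a) × T (p b))
count≥2⇒witnesses {suc n} p h with p zero in p₀
... | true with count≥1⇒witness (tail p) (s≤s⁻¹ h)
...   | b , pb = zero , suc b , (λ ()) , subst T (sym p₀) tt , pb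
count≥2⇒witnesses {suc n} p h | false with count≥2⇒witnesses (tail p) h
...   | a , b , a≢b , pa , pb = suc a , suc b , (λ sa≡sb → a≢b (suc-injective sa≡sb)) , pa , pb

∧-not-∧-⇒∧-not : ∀ x s y → T ((x ∧ s) ∧ not (y ∧ s)) → T (x ∧ not y)
∧-not-∧-⇒∧-not true  true  false t = t
∧-not-∧-⇒∧-not true  true  true  ()
∧-not-∧-⇒∧-not true  false y     ()
∧-not-∧-⇒∧-not false s     y     ()

+≡3∧2≤m⇒n≤1 : ∀ m n → m + n ≡ 3 → 2 ≤ m → n ≤ 1
+≡3∧2≤m⇒n≤1 (suc zero)             n    _    (s≤s ())
+≡3∧2≤m⇒n≤1 (suc (suc zero))       n    refl _ = s≤s z≤n
+≡3∧2≤m⇒n≤1 (suc (suc (suc zero))) zero refl _ = z≤n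

+≡3∧2≰m⇒2≤n : ∀ m n → m + n ≡ 3 → ¬ (2 ≤ m) → 2 ≤ n
+≡3∧2≰m⇒2≤n zero          n refl _   = s≤s (s≤s z≤n)
+≡3∧2≰m⇒2≤n (suc zero)    n refl _   = s≤s (s≤s z≤n)
+≡3∧2≰m⇒2≤n (suc (suc m)) n _    2≰m = ⊥-elim (2≰m (s≤s (s≤s z≤n)))

module _ (G : Graph n) where

  commonNbrs : Fin n → Fin n → ℕ
  commonNbrs u v = count (λ w → adj G u w ∧ adj G v w)

  nbrsDiff : Fin n → Fin n → ℕ
  nbrsDiff u v = count (λ w → adj G u w ∧ not (adj G v w))

  deg≡commonNbrs+nbrsDiff : ∀ u v → deg G u ≡ commonNbrs u v + nbrsDiff u v
  deg≡commonNbrs+nbrsDiff u v = count-split (adj G u) (adj G v)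

  nbSdiff≤nbrsDiff : ∀ S u v → nbSdiff G S u v ≤ nbrsDiff u v
  nbSdiff≤nbrsDiff S u v =
    count-mono _ _ (λ w → ∧-not-∧-⇒∧-not (adj G u w) (S w) (adj G v w))

  nbSdiff-all≡nbrsDiff : ∀ u v → nbSdiff G (λ _ → true) u v ≡ nbrsDiff u v
  nbSdiff-all≡nbrsDiff u v =
    count-cong (λ w → cong₂ (λ x y → x ∧ not y) (∧-identityʳ (adj G u w)) (∧-identityʳ (adj G v w)))

  nbS-all≡deg : ∀ v → nbS G (λ _ → true) v ≡ deg G v
  nbS-all≡deg v = count-cong (λ w → ∧-identityʳ (adj G v w))

  adj⇒≢ : ∀ {x y} → T (adj G x y) → x ≢ y
  adj⇒≢ {x} xy refl = subst T (irrefl G x) xy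

  adj-sym : ∀ {x y} → T (adj G x y) → T (adj G y x)
  adj-sym {x} {y} = subst T (Graph.sym G x y)

  HasC4⇒commonNbrs≥2 : HasC4 G → ∃[ a ] ∃[ c ] (a ≢ c × 2 ≤ commonNbrs a c × 2 ≤ commonNbrs c a)
  HasC4⇒commonNbrs≥2 (a , b , c , d , (_ , a≢c , _ , _ , b≢d , _) , (ab , bc , cd , da)) =
    a , c , a≢c ,
    count≥2 _ b d b≢d (Equivalence.from T-∧ (ab , adj-sym bc)) (Equivalence.from T-∧ (adj-sym da , cd)) ,
    count≥2 _ b d b≢d (Equivalence.from T-∧ (adj-sym bc , ab)) (Equivalence.from T-∧ (cd , adj-sym da))

  commonNbrs≥2⇒HasC4 : ∀ u v → u ≢ v → 2 ≤ commonNbrs u v → HasC4 G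
  commonNbrs≥2⇒HasC4 u v u≢v h with count≥2⇒witnesses _ h
  ... | w , w′ , w≢w′ , uvw , uvw′
    with Equivalence.to T-∧ uvw | Equivalence.to T-∧ uvw′
  ...  | uw , vw | uw′ , vw′ =
    u , w , v , w′ ,
    (adj⇒≢ uw , u≢v , adj⇒≢ uw′ , (λ w≡v → adj⇒≢ vw (sym w≡v)) , w≢w′ , adj⇒≢ vw′) ,
    (uw , adj-sym vw , vw′ , adj-sym uw′)

  module _ (cubic : Cubic G) where

    commonNbrs+nbrsDiff≡3 : ∀ u v → commonNbrs u v + nbrsDiff u v ≡ 3
    commonNbrs+nbrsDiff≡3 u v = trans (sym (deg≡commonNbrs+nbrsDiff u v)) (cubic u)

    commonNbrs≥2⇒nbSdiff≤1 : ∀ S u v → 2 ≤ commonNbrs u v → nbSdiff G S u v ≤ 1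
    commonNbrs≥2⇒nbSdiff≤1 S u v h =
      ≤-trans (nbSdiff≤nbrsDiff S u v) (+≡3∧2≤m⇒n≤1 _ _ (commonNbrs+nbrsDiff≡3 u v) h)

    HasDETOLD⇒¬HasC4 : HasDETOLD G → ¬ HasC4 G
    HasDETOLD⇒¬HasC4 (S , _ , separates) c4 with HasC4⇒commonNbrs≥2 c4
    ... | a , c , a≢c , ac , ca with separates a c a≢c
    ...   | inj₁ 2≤ac = ≤⇒≯ (commonNbrs≥2⇒nbSdiff≤1 S a c ac) 2≤ac
    ...   | inj₂ 2≤ca = ≤⇒≯ (commonNbrs≥2⇒nbSdiff≤1 S c a ca) 2≤ca

    ¬HasC4⇒IsDETOLD-all : ¬ HasC4 G → IsDETOLD G (λ _ → true)
    ¬HasC4⇒IsDETOLD-all noC4 = dominating , separating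
      where
      dominating : ∀ v → nbS G (λ _ → true) v ≥ 2
      dominating v = subst (2 ≤_) (sym (trans (nbS-all≡deg v) (cubic v))) (s≤s (s≤s z≤n))
      separating : ∀ u v → u ≢ v →
        (nbSdiff G (λ _ → true) u v ≥ 2) ⊎ (nbSdiff G (λ _ → true) v u ≥ 2)
      separating u v u≢v = inj₁ (subst (2 ≤_) (sym (nbSdiff-all≡nbrsDiff u v))
        (+≡3∧2≰m⇒2≤n _ _ (commonNbrs+nbrsDiff≡3 u v) (λ h → noC4 (commonNbrs≥2⇒HasC4 u v u≢v h))))

mainTheorem7 : (n : ℕ) (G : Graph n) → Cubic G → (HasDETOLD G ⇔ (¬ HasC4 G))
mainTheorem7 n G cubic =
  mk⇔ (HasDETOLD⇒¬HasC4 G cubic) (λ noC4 → (λ _ → true) , ¬HasC4⇒IsDETOLD-all G cubic noC4)
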